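{- Let $\mathcal T$ be a finite rooted tree of depth $H$ in which each non-leaf node has at most $b$ children, and let $(X_m)_{m\ge0}$ be generated by the negative feedback algorithm on $\mathcal T$ starting at the root. Then, before all nodes have been visited at least once, each node is visited at most $2(b+1)H$ times.
   Context: Negative feedback algorithm: for an edge from $i$ to $j$, let $N_{ij}^{(m)}$ be the number of times $t<m$ with $X_t=i,X_{t+1}=j$. Let $Smin_i^{(m)}$ be the set of neighbours $j$ of $i$ minimizing $N_{ij}^{(m)}$. If $X_m=i$, then given the past, $X_{m+1}$ is uniformly distributed on $Smin_i^{(m)}$. -}

module Defs where

open import Data.Nat using (ℕ; zero; suc; _+_; _*_; _≤_; _<_)
open import Data.Fin using (Fin; zero; suc; toℕ; _≟_)
open import Data.Bool using (Bool; true; false; if_then_else_)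
open import Data.Product using (Σ; _×_; ∃)
open import Relation.Nullary using (¬_; does)
open import Relation.Binary.PropositionalEquality using (_≡_; _≢_)

countFin : ∀ {k} → (Fin k → Bool) → ℕ
countFin {zero}  p = 0
countFin {suc k} p = (if p zero then 1 else 0) + countFin (λ j → p (suc j))

-- A finite rooted tree with node set Fin (suc n) and root zero.
-- Node (suc j) has parent (parent j); parents have smaller labels,
-- which makes the parent relation acyclic, so this is exactly a rooted tree
-- (every finite rooted tree admits such a labelling, e.g. BFS order).
record RootedTree : Set where
  field
    n        : ℕ
    parent   : Fin n → Fin (suc n)
    parent<  : ∀ j → toℕ (parent j) ≤ toℕ j   -- i.e. toℕ (parent j) < toℕ (suc j)

module _ (T : RootedTree) where
  open RootedTree T

  Node : Set
  Node = Fin (suc n)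

  root : Node
  root = zero

  parentOf : Node → Node
  parentOf zero    = zero
  parentOf (suc j) = parent j

  anc : ℕ → Node → Node
  anc zero    v = v
  anc (suc k) v = anc k (parentOf v)

  HasDepth : ℕ → Set
  HasDepth H = (∀ v → anc H v ≡ root) × (∀ H' → (∀ v → anc H' v ≡ root) → H ≤ H')

  nChildren : Node → ℕ
  nChildren i = countFin (λ j → does (parent j ≟ i))

  BranchingAtMost : ℕ → Set
  BranchingAtMost b = ∀ i → 0 < nChildren i → nChildren i ≤ b

  data Adj : Node → Node → Set where
    up   : ∀ j → Adj (suc j) (parent j)
    down : ∀ j → Adj (parent j) (suc j)

  N : Node → Node → (ℕ → Node) → ℕ → ℕ
  N i j X zero    = 0
  N i j X (suc t) =
    (if does (X t ≟ i) then (if does (X (suc t) ≟ j) then 1 else 0) else 0) + N i j X t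

  InSmin : (ℕ → Node) → ℕ → Node → Node → Set
  InSmin X m i j = Adj i j × (∀ k → Adj i k → N i j X m ≤ N i k X m)

  -- X is a possible trajectory of the negative feedback algorithm from the root:
  -- X 0 = root and each step goes to an element of Smin (the support of the
  -- uniform choice on Smin).
  NFTrajectory : (ℕ → Node) → Set
  NFTrajectory X = (X 0 ≡ root) × (∀ m → InSmin X m (X m) (X (suc m)))

  visits : (ℕ → Node) → Node → ℕ → ℕ
  visits X v zero    = 0
  visits X v (suc t) = (if does (X t ≟ v) then 1 else 0) + visits X v t

  NotCovered : (ℕ → Node) → ℕ → Set
  NotCovered X m = ∃ λ v → ∀ t → t ≤ m → X t ≢ v

{-# OPTIONS --safe #-}
-- The walk starts at the root, so along every edge parent → child the
-- downward and upward crossings alternate; in particular the node currently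
-- occupied has left towards any neighbour at most as often as it has been
-- entered from there.  As the algorithm always leaves along a least used edge,
-- every exit count of a node exceeds every entry count by at most one, so a
-- bound c on the exit counts of a node bounds those of each neighbour by c + 1.
-- A node not yet visited has exit counts 0; walking up at most H edges to the
-- root and down at most H edges bounds every exit count by 2H.  Every visit is
-- followed by an exit towards one of at most b + 1 neighbours.
module Submission where

open import Defs
open import Data.Nat using (ℕ; zero; suc; _+_; _*_; _≤_; _<_; z≤n; s≤s)
open import Data.Nat.Properties
  using (≤-refl; ≤-reflexive; ≤-trans; n≤1+n; m≤n+m; m≤n⇒m≤1+n; <⇒≱; +-suc; +-identityʳ; +-mono-≤; +-mono-≤-<; *-monoˡ-≤; module ≤-Reasoning)
open import Data.Nat.Tactic.RingSolver using (solve-∀)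
open import Data.Fin using (Fin; zero; suc; toℕ; _≟_)
open import Data.Fin.Properties using (suc-injective)
open import Data.Bool using (Bool; true; false; if_then_else_) renaming (T to IsTrue)
open import Data.Unit using (tt)
open import Data.Product using (_×_; ∃; _,_; proj₁; proj₂)
open import Data.Sum using (_⊎_; inj₁; inj₂)
open import Data.Empty using (⊥-elim)
open import Relation.Nullary using (¬_; Dec; does; yes; no)
open import Relation.Nullary.Decidable using (dec-true; dec-false; _×-dec_)
open import Relation.Binary.PropositionalEquality
  using (_≡_; _≢_; refl; sym; trans; cong; subst; subst₂; module ≡-Reasoning)

sumFin : ∀ {k} → (Fin k → ℕ) → ℕ
sumFin {zero}  f = 0
sumFin {suc k} f = f zero + sumFin (λ j → f (suc j))

sumFin-mono-≤ : ∀ {k} {f g : Fin k → ℕ} → (∀ i → f i ≤ g i) → sumFin f ≤ sumFin g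
sumFin-mono-≤ {zero}  f≤g = z≤n
sumFin-mono-≤ {suc k} f≤g = +-mono-≤ (f≤g zero) (sumFin-mono-≤ (λ j → f≤g (suc j)))

sumFin-mono-< : ∀ {k} {f g : Fin k → ℕ} → (∀ i → f i ≤ g i) → ∀ i → f i < g i → sumFin f < sumFin g
sumFin-mono-< f≤g zero    fi<gi = +-mono-≤ fi<gi (sumFin-mono-≤ (λ j → f≤g (suc j)))
sumFin-mono-< f≤g (suc i) fi<gi = +-mono-≤-< (f≤g zero) (sumFin-mono-< (λ j → f≤g (suc j)) i fi<gi)

sumFin-if≤countFin* : ∀ {k} (p : Fin k → Bool) {g : Fin k → ℕ} {C : ℕ} →
  (∀ j → IsTrue (p j) → g j ≤ C) → sumFin (λ j → if p j then g j else 0) ≤ countFin p * C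
sumFin-if≤countFin* {zero}  p g≤C = z≤n
sumFin-if≤countFin* {suc k} p g≤C with p zero | g≤C zero
... | true  | g₀≤C = +-mono-≤ (g₀≤C tt) (sumFin-if≤countFin* (λ j → p (suc j)) (λ j → g≤C (suc j)))
... | false | _    = sumFin-if≤countFin* (λ j → p (suc j)) (λ j → g≤C (suc j))

does-witness : ∀ {A : Set} (d : Dec A) → IsTrue (does d) → A
does-witness (yes a) _ = a

if-then-0-mono : ∀ (p : Bool) {x y : ℕ} → x ≤ y → (if p then x else 0) ≤ (if p then y else 0)
if-then-0-mono true  x≤y = x≤y
if-then-0-mono false x≤y = z≤n

module _ (T : RootedTree) where
  open RootedTree T

  nChildren≤ : ∀ {b} → BranchingAtMost T b → ∀ v → nChildren T v ≤ b
  nChildren≤ branching v with nChildren T v | branching v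
  ... | zero  | _     = z≤n
  ... | suc k | bound = bound (s≤s z≤n)

  Adj-sym : ∀ {v w} → Adj T v w → Adj T w v
  Adj-sym (up j)   = down j
  Adj-sym (down j) = up j

  toℕ-parentOf≤ : ∀ v → toℕ (parentOf T v) ≤ toℕ v
  toℕ-parentOf≤ zero    = z≤n
  toℕ-parentOf≤ (suc j) = m≤n⇒m≤1+n (parent< j)

  toℕ-anc≤ : ∀ k v → toℕ (anc T k v) ≤ toℕ v
  toℕ-anc≤ zero    v = ≤-refl
  toℕ-anc≤ (suc k) v = ≤-trans (toℕ-anc≤ k (parentOf T v)) (toℕ-parentOf≤ v)

  anc-root : ∀ k → anc T k (root T) ≡ root T
  anc-root zero    = refl
  anc-root (suc k) = anc-root k

  Descends : Node T → Node T → Set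
  Descends v c = ∃ λ k → anc T k v ≡ c

  ¬parent-descends : ∀ j → ¬ Descends (parent j) (suc j)
  ¬parent-descends j (k , anc≡) =
    <⇒≱ (s≤s ≤-refl) (≤-trans (≤-reflexive (cong toℕ (sym anc≡))) (≤-trans (toℕ-anc≤ k (parent j)) (parent< j)))

  ¬root-descends : ∀ j → ¬ Descends (root T) (suc j)
  ¬root-descends j (k , anc≡) with trans (sym (anc-root k)) anc≡
  ... | ()

  parent≢suc : ∀ j → parent j ≢ suc j
  parent≢suc j p≡s = ¬parent-descends j (0 , p≡s)

  descends-forward : ∀ j {a w} → Adj T a w → ¬ (a ≡ parent j × w ≡ suc j) → ¬ (a ≡ suc j × w ≡ parent j) →
    Descends a (suc j) → Descends w (suc j)
  descends-forward j (up i)   ¬down ¬up (zero , i≡j) = ⊥-elim (¬up (i≡j , cong parent (suc-injective i≡j)))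
  descends-forward j (up i)   ¬down ¬up (suc k , anc≡) = k , anc≡
  descends-forward j (down i) ¬down ¬up (k , anc≡) = suc k , anc≡

  descends-backward : ∀ j {a w} → Adj T a w → ¬ (a ≡ parent j × w ≡ suc j) → ¬ (a ≡ suc j × w ≡ parent j) →
    Descends w (suc j) → Descends a (suc j)
  descends-backward j (up i)   ¬down ¬up (k , anc≡) = suc k , anc≡
  descends-backward j (down i) ¬down ¬up (zero , i≡j) = ⊥-elim (¬down (cong parent (suc-injective i≡j) , i≡j))
  descends-backward j (down i) ¬down ¬up (suc k , anc≡) = k , anc≡

module NegativeFeedback (T : RootedTree) (X : ℕ → Node T) (trajectory : NFTrajectory T X) where
  open RootedTree T

  N' : Node T → Node T → ℕ → ℕ
  N' a z = N T a z X

  step-adj : ∀ m → Adj T (X m) (X (suc m))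
  step-adj m = proj₁ (proj₂ trajectory m)

  step-min : ∀ m {k} → Adj T (X m) k → N' (X m) (X (suc m)) m ≤ N' (X m) k m
  step-min m = proj₂ (proj₂ trajectory m) _

  N-hit : ∀ {a z m} → X m ≡ a → X (suc m) ≡ z → N' a z (suc m) ≡ suc (N' a z m)
  N-hit {a} {z} {m} Xm≡a Xsm≡z rewrite dec-true (X m ≟ a) Xm≡a | dec-true (X (suc m) ≟ z) Xsm≡z = refl

  N-miss : ∀ {a z m} → ¬ (X m ≡ a × X (suc m) ≡ z) → N' a z (suc m) ≡ N' a z m
  N-miss {a} {z} {m} ¬step with X m ≟ a
  ... | yes Xm≡a rewrite dec-false (X (suc m) ≟ z) (λ Xsm≡z → ¬step (Xm≡a , Xsm≡z)) = refl
  ... | no _     = refl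

  N-mono : ∀ a z m → N' a z m ≤ N' a z (suc m)
  N-mono a z m = m≤n+m _ _

  N-unvisited : ∀ {u} z m → (∀ t → t < m → X t ≢ u) → N' u z m ≡ 0
  N-unvisited z zero    unvisited = refl
  N-unvisited z (suc m) unvisited =
    trans (N-miss (λ step → unvisited m ≤-refl (proj₁ step))) (N-unvisited z m (λ t t<m → unvisited t (m≤n⇒m≤1+n t<m)))

  N↓ N↑ : Fin n → ℕ → ℕ
  N↓ j = N' (parent j) (suc j)
  N↑ j = N' (suc j) (parent j)

  EdgeCrossings : Fin n → ℕ → Set
  EdgeCrossings j m = (N↓ j m ≡ N↑ j m × ¬ Descends T (X m) (suc j))
                    ⊎ (N↓ j m ≡ suc (N↑ j m) × Descends T (X m) (suc j))

  edgeCrossings-step : ∀ j m → EdgeCrossings j m → EdgeCrossings j (suc m)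
  edgeCrossings-step j m crossings with (X m ≟ parent j) ×-dec (X (suc m) ≟ suc j)
  edgeCrossings-step j m (inj₂ (_ , inside)) | yes (Xm≡p , _) = ⊥-elim (¬parent-descends T j (subst (λ x → Descends T x (suc j)) Xm≡p inside))
  edgeCrossings-step j m (inj₁ (balanced , _)) | yes (Xm≡p , Xsm≡s) = inj₂ (↓≡ , (0 , Xsm≡s))
    where
    open ≡-Reasoning
    ↓≡ : N↓ j (suc m) ≡ suc (N↑ j (suc m))
    ↓≡ = begin
      N↓ j (suc m)        ≡⟨ N-hit Xm≡p Xsm≡s ⟩
      suc (N↓ j m)        ≡⟨ cong suc balanced ⟩
      suc (N↑ j m)        ≡⟨ cong suc (sym (N-miss (λ step → parent≢suc T j (trans (sym Xm≡p) (proj₁ step))))) ⟩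
      suc (N↑ j (suc m))  ∎
  ... | no ¬down with (X m ≟ suc j) ×-dec (X (suc m) ≟ parent j)
  edgeCrossings-step j m (inj₁ (_ , outside)) | no ¬down | yes (Xm≡s , _) = ⊥-elim (outside (0 , Xm≡s))
  edgeCrossings-step j m (inj₂ (unbalanced , _)) | no ¬down | yes (Xm≡s , Xsm≡p) = inj₁ (↓≡ , leaves)
    where
    open ≡-Reasoning
    ↓≡ : N↓ j (suc m) ≡ N↑ j (suc m)
    ↓≡ = begin
      N↓ j (suc m)        ≡⟨ N-miss (λ step → parent≢suc T j (trans (sym (proj₁ step)) Xm≡s)) ⟩
      N↓ j m              ≡⟨ unbalanced ⟩
      suc (N↑ j m)        ≡⟨ sym (N-hit Xm≡s Xsm≡p) ⟩
      N↑ j (suc m)        ∎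
    leaves : ¬ Descends T (X (suc m)) (suc j)
    leaves inside = ¬parent-descends T j (subst (λ x → Descends T x (suc j)) Xsm≡p inside)
  edgeCrossings-step j m (inj₁ (balanced , outside)) | no ¬down | no ¬up =
    inj₁ (trans (N-miss ¬down) (trans balanced (sym (N-miss ¬up))) ,
          λ inside → outside (descends-backward T j (step-adj m) ¬down ¬up inside))
  edgeCrossings-step j m (inj₂ (unbalanced , inside)) | no ¬down | no ¬up =
    inj₂ (trans (N-miss ¬down) (trans unbalanced (cong suc (sym (N-miss ¬up)))) ,
          descends-forward T j (step-adj m) ¬down ¬up inside)

  edgeCrossings : ∀ j m → EdgeCrossings j m
  edgeCrossings j zero    = inj₁ (refl , λ inside → ¬root-descends T j (subst (λ x → Descends T x (suc j)) (proj₁ trajectory) inside))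
  edgeCrossings j (suc m) = edgeCrossings-step j m (edgeCrossings j m)

  N-out≤N-in-at : ∀ {a b} m → X m ≡ a → Adj T a b → N' a b m ≤ N' b a m
  N-out≤N-in-at m Xm≡a (up j) with edgeCrossings j m
  ... | inj₁ (_ , outside)   = ⊥-elim (outside (0 , Xm≡a))
  ... | inj₂ (unbalanced , _) = ≤-trans (n≤1+n _) (≤-reflexive (sym unbalanced))
  N-out≤N-in-at m Xm≡a (down j) with edgeCrossings j m
  ... | inj₁ (balanced , _) = ≤-reflexive balanced
  ... | inj₂ (_ , inside)   = ⊥-elim (¬parent-descends T j (subst (λ x → Descends T x (suc j)) Xm≡a inside))

  -- When the walk last left a towards z, the edge a → z was least used, and
  -- the count a → b was then at most the count b → a.
  N-out≤1+N-in : ∀ m {a b z} → Adj T a b → Adj T a z → N' a z m ≤ suc (N' b a m)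
  N-out≤1+N-in zero    ab az = z≤n
  N-out≤1+N-in (suc m) {a} {b} {z} ab az with (X m ≟ a) ×-dec (X (suc m) ≟ z)
  ... | yes (refl , refl) =
    ≤-trans (≤-reflexive (N-hit refl refl))
      (s≤s (≤-trans (step-min m ab) (≤-trans (N-out≤N-in-at m refl ab) (N-mono b a m))))
  ... | no ¬step =
    ≤-trans (≤-reflexive (N-miss ¬step)) (≤-trans (N-out≤1+N-in m ab az) (s≤s (N-mono b a m)))

  OutBounded : ℕ → Node T → ℕ → Set
  OutBounded m v c = ∀ z → Adj T v z → N' v z m ≤ c

  module _ (m : ℕ) where

    outBounded-weaken : ∀ v {c c'} → c ≤ c' → OutBounded m v c → OutBounded m v c'
    outBounded-weaken v c≤c' bound z adj = ≤-trans (bound z adj) c≤c'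

    outBounded-adj : ∀ {v w c} → Adj T v w → OutBounded m v c → OutBounded m w (suc c)
    outBounded-adj vw bound z wz = ≤-trans (N-out≤1+N-in m (Adj-sym T vw) wz) (s≤s (bound _ vw))

    outBounded-parentOf : ∀ v {c} → OutBounded m v c → OutBounded m (parentOf T v) (suc c)
    outBounded-parentOf zero    = outBounded-weaken zero (n≤1+n _)
    outBounded-parentOf (suc j) = outBounded-adj (up j)

    outBounded-fromParent : ∀ v {c} → OutBounded m (parentOf T v) c → OutBounded m v (suc c)
    outBounded-fromParent zero    = outBounded-weaken zero (n≤1+n _)
    outBounded-fromParent (suc j) = outBounded-adj (down j)

    outBounded-anc : ∀ k v {c} → OutBounded m v c → OutBounded m (anc T k v) (k + c)
    outBounded-anc zero    v bound = bound
    outBounded-anc (suc k) v {c} bound = outBounded-weaken (anc T (suc k) v) (≤-reflexive (+-suc k c))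
      (outBounded-anc k (parentOf T v) (outBounded-parentOf v bound))

    outBounded-fromAnc : ∀ k v {c} → OutBounded m (anc T k v) c → OutBounded m v (k + c)
    outBounded-fromAnc zero    v bound = bound
    outBounded-fromAnc (suc k) v bound = outBounded-fromParent v (outBounded-fromAnc k (parentOf T v) bound)

  exitsUp exitsDown exits : Node T → ℕ → ℕ
  exitsUp zero    m = 0
  exitsUp (suc j) m = N' (suc j) (parent j) m
  exitsDown v m = sumFin (λ j → if does (parent j ≟ v) then N' v (suc j) m else 0)
  exits v m = exitsUp v m + exitsDown v m

  exitsUp-mono : ∀ v m → exitsUp v m ≤ exitsUp v (suc m)
  exitsUp-mono zero    m = z≤n
  exitsUp-mono (suc j) m = N-mono _ _ m

  exitsDown-mono : ∀ v m → exitsDown v m ≤ exitsDown v (suc m)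
  exitsDown-mono v m = sumFin-mono-≤ (λ j → if-then-0-mono (does (parent j ≟ v)) (N-mono v (suc j) m))

  exits-mono : ∀ v m → exits v m ≤ exits v (suc m)
  exits-mono v m = +-mono-≤ (exitsUp-mono v m) (exitsDown-mono v m)

  exits-step : ∀ {v w} m → X m ≡ v → X (suc m) ≡ w → Adj T v w → exits v m < exits v (suc m)
  exits-step m Xm≡v Xsm≡w (up j) = +-mono-≤ (≤-reflexive (sym (N-hit Xm≡v Xsm≡w))) (exitsDown-mono (suc j) m)
  exits-step m Xm≡v Xsm≡w (down j) = +-mono-≤-< (exitsUp-mono (parent j) m)
    (sumFin-mono-< (λ i → if-then-0-mono (does (parent i ≟ parent j)) (N-mono (parent j) (suc i) m)) j edge<)
    where
    edge< : (if does (parent j ≟ parent j) then N' (parent j) (suc j) m else 0)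
          < (if does (parent j ≟ parent j) then N' (parent j) (suc j) (suc m) else 0)
    edge< rewrite dec-true (parent j ≟ parent j) refl = ≤-reflexive (sym (N-hit Xm≡v Xsm≡w))

  visit+exits≤exits : ∀ v m → (if does (X m ≟ v) then 1 else 0) + exits v m ≤ exits v (suc m)
  visit+exits≤exits v m = by-cases (X m ≟ v)
    where
    by-cases : (d : Dec (X m ≡ v)) → (if does d then 1 else 0) + exits v m ≤ exits v (suc m)
    by-cases (yes Xm≡v) = exits-step m Xm≡v refl (subst (λ x → Adj T x (X (suc m))) Xm≡v (step-adj m))
    by-cases (no _)     = exits-mono v m

  visits≤exits : ∀ v m → visits T X v m ≤ exits v m
  visits≤exits v zero    = z≤n
  visits≤exits v (suc m) = ≤-trans (+-mono-≤ ≤-refl (visits≤exits v m)) (visit+exits≤exits v m)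

  exits≤ : ∀ {m v c} → OutBounded m v c → exits v m ≤ suc (nChildren T v) * c
  exits≤ {m} {v} {c} bound = +-mono-≤ (exitsUp≤ v bound)
    (sumFin-if≤countFin* (λ j → does (parent j ≟ v))
      (λ j p≡v → bound (suc j) (subst (λ x → Adj T x (suc j)) (does-witness (parent j ≟ v) p≡v) (down j))))
    where
    exitsUp≤ : ∀ v → OutBounded m v c → exitsUp v m ≤ c
    exitsUp≤ zero    _     = z≤n
    exitsUp≤ (suc j) bound = bound (parent j) (up j)

suc-b*[h+h]≡2*[b+1]*h : ∀ b h → suc b * (h + h) ≡ 2 * (b + 1) * h
suc-b*[h+h]≡2*[b+1]*h = solve-∀

theorem7 : (T : RootedTree) (H b : ℕ) → HasDepth T H → BranchingAtMost T b →
           (X : ℕ → Node T) → NFTrajectory T X →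
           ∀ m → NotCovered T X m →
           ∀ v → visits T X v (suc m) ≤ 2 * (b + 1) * H
theorem7 T H b (reachesRoot , _) branching X trajectory m (u , unvisited) v = begin
  visits T X v (suc m)          ≤⟨ visits≤exits v (suc m) ⟩
  exits v (suc m)               ≤⟨ exits≤ bound ⟩
  suc (nChildren T v) * (H + H) ≤⟨ *-monoˡ-≤ (H + H) (s≤s (nChildren≤ T branching v)) ⟩
  suc b * (H + H)               ≡⟨ suc-b*[h+h]≡2*[b+1]*h b H ⟩
  2 * (b + 1) * H               ∎
  where
  open NegativeFeedback T X trajectory
  open ≤-Reasoning
  unvisitedBound : OutBounded (suc m) u 0
  unvisitedBound z _ = ≤-reflexive (N-unvisited z (suc m) (λ { t (s≤s t≤m) → unvisited t t≤m }))
  rootBound : OutBounded (suc m) (root T) H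
  rootBound = subst₂ (OutBounded (suc m)) (reachesRoot u) (+-identityʳ H) (outBounded-anc (suc m) H u unvisitedBound)
  bound : OutBounded (suc m) v (H + H)
  bound = outBounded-fromAnc (suc m) H v (subst (λ x → OutBounded (suc m) x H) (sym (reachesRoot v)) rootBound)
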